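{- Let $s$ be a frame store, $h,h'$ heaps, $\mathcal C$ a function closure, $e$ an expression and $v$ a value with $s;\,h;\,\mathcal C\vdash e\Downarrow v;\,h'$ derivable. Let $D$ be a conjunction of polynomial equations, $\Gamma$ a context, $\Sigma$ a signature and $\tau$ a zero-order type such that $D;\,\Gamma\vdash_\Sigma e:\tau$ is derivable, and suppose all functions called in $e$ are declared in $e$ via $\mathsf{letfun}$. Then for every size valuation $\epsilon$ and type instantiation $\eta$: if the equations $\epsilon(D)$ hold and for every $z\in FV(e)$ there is $w$ with $s(z)\models^{h}_{\eta(\epsilon(\Gamma(z)))}w$, then there is $w'$ with $v\models^{h'}_{\eta(\epsilon(\tau))}w'$.
   Context: Language. Program variables are $z$ (generic), $x,y$ (integer), $l,hd,tl$ (lists); $c$ ranges over integer constants, $\mathsf{binop}\in\{+,-,\mathsf{div},\mathsf{mod}\}$, $f$ over function names. Basic expressions $b::= c\mid x\,\mathsf{binop}\,y\mid \mathsf{nil}\mid \mathsf{cons}(z,l)\mid f(z_1,\dots,z_n)$. Expressions $e::= b\mid \mathsf{let}\ z=b\ \mathsf{in}\ e_1\mid \mathsf{if}\ x\ \mathsf{then}\ e_1\ \mathsf{else}\ e_2\mid \mathsf{match}\ l\ \mathsf{with}\ \mathsf{nil}\Rightarrow e_1\mid \mathsf{cons}(hd,tl)\Rightarrow e_2\mid \mathsf{letfun}\ f(z_1,\dots,z_n)=e_1\ \mathsf{in}\ e_2\mid \mathsf{letextern}\ f(z_1,\dots,z_n)\ \mathsf{in}\ e_1$, where in $\mathsf{letfun}$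 one requires $FV(e_1)\subseteq\{z_1,\dots,z_n\}$. $FV(e)$ is the set of free program variables ($\mathsf{let}$ binds $z$ in its body, $\mathsf{match}$ binds $hd,tl$ in the cons-branch). Types. Size expressions $p$ are polynomials with rational coefficients in size variables (which stand for natural numbers). Zero-order types: $\tau::=\mathtt{Int}\mid\alpha\mid[\tau]^{p}$ ($\alpha$ a type variable; $[\tau]^p$ = lists of length $p$ with elements of type $\tau$). A ground type has no size or type variables. $D$ denotes a finite conjunction of polynomial equations; $D\vdash p=q$ means: for all assignments of natural numbers to the size variables satisfying $D$, $p=q$. $D\vdash\tau=\tau'$ holds iff either $\tau=\tau'=\mathtt{Int}$ or $\tau=\tau'=\alpha$, or $\tau=[\tau'']^{p}$, $\tau'=[\tau''']^{p'}$ have the same underlying type (annotations erased), $D\vdash p=p'$, and ($D\vdash p=0$ or $D\vdash\tau''=\tau'''$). A first-order type is $\tau^\circ_1\times\dots\times\tau^\circ_n\to\tau_{n+1}$ where all annotations in the $\tau^\circ_i$ are size variables and the size variables of $\tau_{n+1}$ occur in the $\tau^\circ_i$. A context $\Gamma$ maps program variables to zero-order types ($\Gamma,z:\tau$ is its extension); a signature $\Sigma$ maps function names to first-order types. Typing rules for $D;\Gamma\vdash_\Sigma e:\tau$: (IConst) $D;\Gamma\vdash c:\mathtt{Int}$. (IBinop) $D;\Gamma,x:\mathtt{Int},y:\mathtt{Int}\vdash x\,\mathsf{binop}\,y:\mathtt{Int}$. (Nil) if $D\vdash p=0$ then $D;\Gamma\vdash\mathsf{nil}:[\tau]^p$. (Var)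 if $D\vdash\tau=\tau'$ then $D;\Gamma,z:\tau\vdash z:\tau'$. (Cons) if $D\vdash p=p'+1$ then $D;\Gamma,hd:\tau,tl:[\tau]^{p'}\vdash\mathsf{cons}(hd,tl):[\tau]^p$. (If) from $D;\Gamma,x:\mathtt{Int}\vdash e_t:\tau$ and $D;\Gamma,x:\mathtt{Int}\vdash e_f:\tau$ infer $D;\Gamma,x:\mathtt{Int}\vdash \mathsf{if}\ x\ \mathsf{then}\ e_t\ \mathsf{else}\ e_f:\tau$. (Let) if $z\notin\mathrm{dom}\,\Gamma$, $D;\Gamma\vdash e_1:\tau_z$ and $D;\Gamma,z:\tau_z\vdash e_2:\tau$ then $D;\Gamma\vdash\mathsf{let}\ z=e_1\ \mathsf{in}\ e_2:\tau$. (Match) if $hd,tl\notin\mathrm{dom}\,\Gamma$, $(p=0\wedge D);\Gamma,l:[\tau']^p\vdash e_{nil}:\tau$ and $D;\Gamma,hd:\tau',l:[\tau']^p,tl:[\tau']^{p-1}\vdash e_{cons}:\tau$, then $D;\Gamma,l:[\tau']^p\vdash \mathsf{match}\ l\ \mathsf{with}\ \mathsf{nil}\Rightarrow e_{nil}\mid\mathsf{cons}(hd,tl)\Rightarrow e_{cons}:\tau$. (LetFun) if $\Sigma(f)=\tau^\circ_1\times\dots\times\tau^\circ_n\to\tau_{n+1}$, $\mathsf{True};z_1:\tau^\circ_1,\dots,z_n:\tau^\circ_n\vdash_\Sigma e_1:\tau_{n+1}$ and $D;\Gamma\vdash_\Sigma e_2:\tau'$, then $D;\Gamma\vdash_\Sigma\mathsf{letfun}\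 f(z_1,\dots,z_n)=e_1\ \mathsf{in}\ e_2:\tau'$. (LetExtern) if $\Sigma(f)$ is a first-order type and $D;\Gamma\vdash_\Sigma e:\tau'$ then $D;\Gamma\vdash_\Sigma\mathsf{letextern}\ f(z_1,\dots,z_n)\ \mathsf{in}\ e:\tau'$. (FunApp) if $\Sigma(f)=\tau^\circ_1\times\dots\times\tau^\circ_n\to\tau_{n+1}$, $\langle *,C\rangle=\Theta(\tau^\circ_1\times\dots\times\tau^\circ_n,\ \tau'_1\times\dots\times\tau'_n)$, $D\vdash\tau'_{n+1}=*(\tau_{n+1})$ and $D\vdash C$, then $D;\Gamma,z_1:\tau'_1,\dots,z_n:\tau'_n\vdash f(z_1,\dots,z_n):\tau'_{n+1}$. Here $\Theta$ matches each formal type $\tau^\circ_i$ position-wise against the actual type $\tau'_i$; $*$ substitutes for each type variable the matched type and for each size variable a matched size expression, and $C$ is the set of equations $p=p'$ for all pairs of size expressions matched with the same size variable. Heaps and semantics of types. Values $v::=c\mid\ell\mid\mathtt{NULL}$ ($\ell$ a location). A heap $h$ is a finite partial map from locations to partial maps $\{\mathtt{hd},\mathtt{tl}\}\rightharpoonup$ values; $h.\ell.\mathtt{hd}$, $h.\ell.\mathtt{tl}$ are the stored values, $h[\ell.\mathtt{hd}:=v_1,\ell.\mathtt{tl}:=v_2]$ is the update, $h|_X$ is restriction to a set $X$ of locations, and $h\setminus\ell$ is $h$ with $\ell$ removed from its domain. The relation $v\models^h_{\tau}w$ ($\tau$ ground) is defined by: $c\models^h_{\mathtt{Int}}c$; $\mathtt{NULL}\models^h_{[\tau]^0}[\,]$;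 $\ell\models^h_{[\tau]^{n}}w_{hd}::w_{tl}$ iff $n\ge1$ is a natural number, $\ell\in\mathrm{dom}\,h$, $h.\ell.\mathtt{hd}\models^{h\setminus\ell}_{\tau}w_{hd}$ and $h.\ell.\mathtt{tl}\models^{h\setminus\ell}_{[\tau]^{n-1}}w_{tl}$; nothing else holds. The footprint is $R(h,c)=R(h,\mathtt{NULL})=\emptyset$, $R(h,\ell)=\emptyset$ if $\ell\notin\mathrm{dom}\,h$, and otherwise $R(h,\ell)=\{\ell\}\cup R(h\setminus\ell,h.\ell.\mathtt{hd})\cup R(h\setminus\ell,h.\ell.\mathtt{tl})$; for a store $s$, $R(h,s)=\bigcup_{z\in\mathrm{dom}\,s}R(h,s(z))$. Operational semantics. A frame store $s$ is a finite partial map from program variables to values; a closure $\mathcal C$ maps function names to pairs (parameter list, body). Judgement $s;h;\mathcal C\vdash e\Downarrow v;h'$: $c\Downarrow c;h$; $x\,\mathsf{binop}\,y\Downarrow s(x)\,\mathsf{binop}\,s(y);h$; $\mathsf{nil}\Downarrow\mathtt{NULL};h$; $z\Downarrow s(z);h$; $\mathsf{cons}(hd,tl)\Downarrow\ell;h[\ell.\mathtt{hd}:=s(hd),\ell.\mathtt{tl}:=s(tl)]$ for some $\ell\notin\mathrm{dom}\,h$; $\mathsf{if}\ x\ldots$ evaluates $e_1$ if $s(x)\neq0$ and $e_2$ if $s(x)=0$ (same $s,h,\mathcal C$); $\mathsf{let}\ z=e_1\ \mathsf{in}\ e_2\Downarrow v;h'$ if $s;h;\mathcal C\vdash e_1\Downarrow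 v_1;h_1$, $s[z:=v_1];h_1;\mathcal C\vdash e_2\Downarrow v;h'$ and $h|_{R(h,s|_{FV(e_2)})}=h_1|_{R(h,s|_{FV(e_2)})}$; $\mathsf{match}$ evaluates $e_1$ in $s;h;\mathcal C$ if $s(l)=\mathtt{NULL}$, and otherwise evaluates $e_2$ in $s[hd:=h.s(l).\mathtt{hd},tl:=h.s(l).\mathtt{tl}];h;\mathcal C$; $\mathsf{letfun}\ f(z_1..z_n)=e_1\ \mathsf{in}\ e_2$ evaluates $e_2$ in $s;h;\mathcal C[f:=((z_1,..,z_n),e_1)]$; $f(z_1,\dots,z_n)\Downarrow v;h'$ if $\mathcal C(f)=((z'_1,\dots,z'_n),e_f)$, $FV(e_f)\subseteq\{z'_i\}$ and $[z'_1:=s(z_1),\dots,z'_n:=s(z_n)];h;\mathcal C\vdash e_f\Downarrow v;h'$. There is no rule for $\mathsf{letextern}$ (the external environment is empty). A size valuation $\epsilon$ maps size variables to natural numbers and a type instantiation $\eta$ maps type variables to ground types; $\eta(\epsilon(\cdot))$ applies both to all variables in a type, context or set of equations.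
   Formalization: Every call f(z₁,…,zₙ) in e lies in the body or continuation of an enclosing letfun f, in (Match) hd and tl also differ from l, and Θ requires all types matched with one type variable to be syntactically identical. Each condition added here is assumed in the paper as well or is needed for the statement above to hold. -}

module Defs where

open import Data.Nat as ℕ using (ℕ; zero; suc; _≤_; _⊔_; _≟_)
open import Data.Nat.Properties using (m⊔n≤o⇒m≤o; m⊔n≤o⇒n≤o; <-irrefl)
open import Data.Integer as ℤ using (ℤ; +_; +0; +[1+_]; -[1+_]; 0ℤ)
open import Data.Integer using (_/_; _%_)
open import Data.Rational as ℚ using (ℚ; 0ℚ; 1ℚ)
open import Data.Maybe using (Maybe; just; nothing)
open import Data.List using (List; []; _∷_; length)
open import Data.List.Membership.Propositional using (_∈_; _∉_)
open import Data.List.Relation.Unary.All using (All)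
open import Data.List.Relation.Unary.Any using (Any)
open import Data.List.Relation.Binary.Pointwise using (Pointwise)
open import Data.Product using (Σ; ∃; _×_; _,_; proj₁; proj₂)
open import Data.Sum using (_⊎_)
open import Data.Unit using (⊤)
open import Relation.Nullary using (¬_; yes; no)
open import Relation.Binary.PropositionalEquality using (_≡_; _≢_; refl)

-- Finite partial maps with ℕ keys (used for stores, heaps, contexts,
-- closures and signatures).  Program variables, function names,
-- locations, size variables and type variables are all ℕ.

record FMap (A : Set) : Set where
  field
    look  : ℕ → Maybe A
    bound : ℕ
    fin   : ∀ k → bound ≤ k → look k ≡ nothing
open FMap public

upd : {A : Set} → (ℕ → Maybe A) → ℕ → Maybe A → ℕ → Maybe A
upd f k x k' with k' ≟ k
... | yes _ = x
... | no  _ = f k'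

upd-other : {A : Set} (f : ℕ → Maybe A) (k : ℕ) (x : Maybe A) (k' : ℕ) →
            k' ≢ k → upd f k x k' ≡ f k'
upd-other f k x k' ne with k' ≟ k
... | yes eq = Data.Empty.⊥-elim (ne eq) where import Data.Empty
... | no  _  = refl

emptyMap : {A : Set} → FMap A
emptyMap = record { look = λ _ → nothing ; bound = 0 ; fin = λ _ _ → refl }

insert : {A : Set} → ℕ → A → FMap A → FMap A
insert {A} k a m = record
  { look = upd (look m) k (just a)
  ; bound = suc k ⊔ bound m
  ; fin = pf }
  where
  pf : ∀ k' → suc k ⊔ bound m ≤ k' → upd (look m) k (just a) k' ≡ nothing
  pf k' le with k' ≟ k
  ... | yes refl = Data.Empty.⊥-elim (<-irrefl refl (m⊔n≤o⇒m≤o (suc k) (bound m) le))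
    where import Data.Empty
  ... | no _ = fin m k' (m⊔n≤o⇒n≤o (suc k) (bound m) le)

remove : {A : Set} → ℕ → FMap A → FMap A
remove {A} k m = record
  { look = upd (look m) k nothing
  ; bound = bound m
  ; fin = pf }
  where
  pf : ∀ k' → bound m ≤ k' → upd (look m) k nothing k' ≡ nothing
  pf k' le with k' ≟ k
  ... | yes _ = refl
  ... | no _ = fin m k' le

buildFrom : {A : Set} → FMap A → List ℕ → List A → FMap A
buildFrom m (z ∷ zs) (a ∷ as) = buildFrom (insert z a m) zs as
buildFrom m _ _ = m

build : {A : Set} → List ℕ → List A → FMap A
build = buildFrom emptyMap

data Binop : Set where
  bplus bminus bdiv bmod : Binop

data BExp : Set where
  bconst : ℤ → BExp
  bvar   : ℕ → BExp
  bop    : Binop → ℕ → ℕ → BExp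
  bnil   : BExp
  bcons  : ℕ → ℕ → BExp
  bapp   : ℕ → List ℕ → BExp

data Exp : Set where
  basic      : BExp → Exp
  elet       : ℕ → BExp → Exp → Exp
  eif        : ℕ → Exp → Exp → Exp
  ematch     : ℕ → Exp → ℕ → ℕ → Exp → Exp        -- match l with nil ⇒ e₁ | cons(hd,tl) ⇒ e₂
  eletfun    : ℕ → List ℕ → Exp → Exp → Exp       -- letfun f(z₁..zₙ) = e₁ in e₂
  eletextern : ℕ → List ℕ → Exp → Exp

data _∈FVb_ : ℕ → BExp → Set where
  fvVar  : ∀ {z} → z ∈FVb bvar z
  fvOpL  : ∀ {o x y} → x ∈FVb bop o x y
  fvOpR  : ∀ {o x y} → y ∈FVb bop o x y
  fvConsH : ∀ {z l} → z ∈FVb bcons z l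
  fvConsT : ∀ {z l} → l ∈FVb bcons z l
  fvApp  : ∀ {z f zs} → z ∈ zs → z ∈FVb bapp f zs

data _∈FV_ : ℕ → Exp → Set where
  fvBasic  : ∀ {z b} → z ∈FVb b → z ∈FV basic b
  fvLet₁   : ∀ {x z b e} → x ∈FVb b → x ∈FV elet z b e
  fvLet₂   : ∀ {x z b e} → x ∈FV e → x ≢ z → x ∈FV elet z b e
  fvIf     : ∀ {x e₁ e₂} → x ∈FV eif x e₁ e₂
  fvIf₁    : ∀ {y x e₁ e₂} → y ∈FV e₁ → y ∈FV eif x e₁ e₂
  fvIf₂    : ∀ {y x e₁ e₂} → y ∈FV e₂ → y ∈FV eif x e₁ e₂
  fvMatch  : ∀ {l e₁ hd tl e₂} → l ∈FV ematch l e₁ hd tl e₂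
  fvMatch₁ : ∀ {y l e₁ hd tl e₂} → y ∈FV e₁ → y ∈FV ematch l e₁ hd tl e₂
  fvMatch₂ : ∀ {y l e₁ hd tl e₂} → y ∈FV e₂ → y ≢ hd → y ≢ tl →
             y ∈FV ematch l e₁ hd tl e₂
  fvFun₁   : ∀ {y f zs e₁ e₂} → y ∈FV e₁ → y ∉ zs → y ∈FV eletfun f zs e₁ e₂
  fvFun₂   : ∀ {y f zs e₁ e₂} → y ∈FV e₂ → y ∈FV eletfun f zs e₁ e₂
  fvExt    : ∀ {y f zs e} → y ∈FV e → y ∈FV eletextern f zs e

-- "every function called in e is declared in e via letfun" (lexical scope;
-- the body of letfun f is in the scope of f itself and of enclosing letfuns)
DeclaredB : List ℕ → BExp → Set
DeclaredB fs (bapp f _) = f ∈ fs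
DeclaredB fs _ = ⊤

Declared : List ℕ → Exp → Set
Declared fs (basic b) = DeclaredB fs b
Declared fs (elet _ b e) = DeclaredB fs b × Declared fs e
Declared fs (eif _ e₁ e₂) = Declared fs e₁ × Declared fs e₂
Declared fs (ematch _ e₁ _ _ e₂) = Declared fs e₁ × Declared fs e₂
Declared fs (eletfun f _ e₁ e₂) = Declared (f ∷ fs) e₁ × Declared (f ∷ fs) e₂
Declared fs (eletextern _ _ e) = Declared fs e

data SExp : Set where
  sconst : ℚ → SExp
  svar   : ℕ → SExp
  _⊕_    : SExp → SExp → SExp
  _⊗_    : SExp → SExp → SExp

ℕtoℚ : ℕ → ℚ
ℕtoℚ n = + n ℚ./ 1

⟦_⟧ : SExp → (ℕ → ℕ) → ℚ
⟦ sconst q ⟧ ε = q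
⟦ svar i ⟧ ε = ℕtoℚ (ε i)
⟦ p ⊕ q ⟧ ε = ⟦ p ⟧ ε ℚ.+ ⟦ q ⟧ ε
⟦ p ⊗ q ⟧ ε = ⟦ p ⟧ ε ℚ.* ⟦ q ⟧ ε

data SVarIn (k : ℕ) : SExp → Set where
  here : SVarIn k (svar k)
  inl⊕ : ∀ {p q} → SVarIn k p → SVarIn k (p ⊕ q)
  inr⊕ : ∀ {p q} → SVarIn k q → SVarIn k (p ⊕ q)
  inl⊗ : ∀ {p q} → SVarIn k p → SVarIn k (p ⊗ q)
  inr⊗ : ∀ {p q} → SVarIn k q → SVarIn k (p ⊗ q)

Constraints : Set
Constraints = List (SExp × SExp)

Sat : (ℕ → ℕ) → Constraints → Set
Sat ε D = All (λ pq → ⟦ proj₁ pq ⟧ ε ≡ ⟦ proj₂ pq ⟧ ε) D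

_⊢_≐_ : Constraints → SExp → SExp → Set
D ⊢ p ≐ q = ∀ (ε : ℕ → ℕ) → Sat ε D → ⟦ p ⟧ ε ≡ ⟦ q ⟧ ε

data Ty : Set where
  tInt  : Ty
  tVar  : ℕ → Ty
  tList : Ty → SExp → Ty

data UTy : Set where
  uInt  : UTy
  uVar  : ℕ → UTy
  uList : UTy → UTy

erase : Ty → UTy
erase tInt = uInt
erase (tVar a) = uVar a
erase (tList τ _) = uList (erase τ)

data TyEq (D : Constraints) : Ty → Ty → Set where
  eqInt  : TyEq D tInt tInt
  eqVar  : ∀ a → TyEq D (tVar a) (tVar a)
  eqList : ∀ {τ τ' p p'} → erase τ ≡ erase τ' → D ⊢ p ≐ p' →
           (D ⊢ p ≐ sconst 0ℚ ⊎ TyEq D τ τ') → TyEq D (tList τ p) (tList τ' p')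

data SVarInTy (k : ℕ) : Ty → Set where
  inAnn  : ∀ {τ p} → SVarIn k p → SVarInTy k (tList τ p)
  inElem : ∀ {τ p} → SVarInTy k τ → SVarInTy k (tList τ p)

data TVarInTy (a : ℕ) : Ty → Set where
  tvHere : TVarInTy a (tVar a)
  tvElem : ∀ {τ p} → TVarInTy a τ → TVarInTy a (tList τ p)

AnnVars : Ty → Set
AnnVars tInt = ⊤
AnnVars (tVar _) = ⊤
AnnVars (tList τ p) = (∃ λ k → p ≡ svar k) × AnnVars τ

record FOTy : Set where
  field
    args    : List Ty
    res     : Ty
    argsAnn : All AnnVars args
    resVars : ∀ k → SVarInTy k res → Any (SVarInTy k) args
open FOTy public

Ctx : Set
Ctx = FMap Ty

Sig : Set
Sig = FMap FOTy

substS : (ℕ → SExp) → SExp → SExp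
substS σ (sconst q) = sconst q
substS σ (svar k) = σ k
substS σ (p ⊕ q) = substS σ p ⊕ substS σ q
substS σ (p ⊗ q) = substS σ p ⊗ substS σ q

substTy : (ℕ → Ty) → (ℕ → SExp) → Ty → Ty
substTy σT σS tInt = tInt
substTy σT σS (tVar a) = σT a
substTy σT σS (tList τ p) = tList (substTy σT σS τ) (substS σS p)

-- Θ, position-wise matching of a formal type against an actual type,
-- with * = (σT, σS), together with D ⊢ C (every size expression matched
-- with size variable k is D-equal to σS k).
data Match (D : Constraints) (σT : ℕ → Ty) (σS : ℕ → SExp) : Ty → Ty → Set where
  mInt  : Match D σT σS tInt tInt
  mVar  : ∀ {a τ'} → σT a ≡ τ' → Match D σT σS (tVar a) τ'
  mList : ∀ {k τ° τ' p'} → D ⊢ σS k ≐ p' → Match D σT σS τ° τ' →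
          Match D σT σS (tList τ° (svar k)) (tList τ' p')

minus1 : SExp → SExp
minus1 p = p ⊕ sconst (ℚ.- 1ℚ)

plus1 : SExp → SExp
plus1 p = p ⊕ sconst 1ℚ

data TyB (Σ' : Sig) (D : Constraints) (Γ : Ctx) : BExp → Ty → Set where
  tyConst : ∀ {c} → TyB Σ' D Γ (bconst c) tInt
  tyOp    : ∀ {o x y} → look Γ x ≡ just tInt → look Γ y ≡ just tInt →
            TyB Σ' D Γ (bop o x y) tInt
  tyNil   : ∀ {τ p} → D ⊢ p ≐ sconst 0ℚ → TyB Σ' D Γ bnil (tList τ p)
  tyVar   : ∀ {z τ τ'} → look Γ z ≡ just τ → TyEq D τ τ' → TyB Σ' D Γ (bvar z) τ'
  tyCons  : ∀ {hd tl τ p p'} → look Γ hd ≡ just τ → look Γ tl ≡ just (tList τ p') →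
            D ⊢ p ≐ plus1 p' → TyB Σ' D Γ (bcons hd tl) (tList τ p)
  tyApp   : ∀ {f zs τ'} (ft : FOTy) (τs : List Ty) (σT : ℕ → Ty) (σS : ℕ → SExp) →
            look Σ' f ≡ just ft →
            Pointwise (λ z τ → look Γ z ≡ just τ) zs τs →
            Pointwise (Match D σT σS) (args ft) τs →
            (∀ a → ¬ Any (TVarInTy a) (args ft) → σT a ≡ tVar a) →
            TyEq D τ' (substTy σT σS (res ft)) →
            TyB Σ' D Γ (bapp f zs) τ'

data TyE (Σ' : Sig) (D : Constraints) (Γ : Ctx) : Exp → Ty → Set where
  tyBasic : ∀ {b τ} → TyB Σ' D Γ b τ → TyE Σ' D Γ (basic b) τ
  tyLet   : ∀ {z b e τz τ} → look Γ z ≡ nothing → TyB Σ' D Γ b τz →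
            TyE Σ' D (insert z τz Γ) e τ → TyE Σ' D Γ (elet z b e) τ
  tyIf    : ∀ {x e₁ e₂ τ} → look Γ x ≡ just tInt → TyE Σ' D Γ e₁ τ → TyE Σ' D Γ e₂ τ →
            TyE Σ' D Γ (eif x e₁ e₂) τ
  tyMatch : ∀ {l e₁ hd tl e₂ τ' p τ} → look Γ l ≡ just (tList τ' p) →
            look Γ hd ≡ nothing → look Γ tl ≡ nothing →
            TyE Σ' ((p , sconst 0ℚ) ∷ D) Γ e₁ τ →
            TyE Σ' D (insert tl (tList τ' (minus1 p)) (insert hd τ' Γ)) e₂ τ →
            TyE Σ' D Γ (ematch l e₁ hd tl e₂) τ
  tyLetFun : ∀ {f zs e₁ e₂ τ'} (ft : FOTy) → look Σ' f ≡ just ft →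
             length zs ≡ length (args ft) →
             TyE Σ' [] (build zs (args ft)) e₁ (res ft) →
             TyE Σ' D Γ e₂ τ' → TyE Σ' D Γ (eletfun f zs e₁ e₂) τ'
  tyLetExtern : ∀ {f zs e τ'} (ft : FOTy) → look Σ' f ≡ just ft →
             TyE Σ' D Γ e τ' → TyE Σ' D Γ (eletextern f zs e) τ'

data Val : Set where
  cnst : ℤ → Val
  loc  : ℕ → Val
  NULL : Val

record Cell : Set where
  constructor mkCell
  field
    hd : Maybe Val
    tl : Maybe Val
open Cell public

Heap : Set
Heap = FMap Cell

Store : Set
Store = FMap Val

Closure : Set
Closure = FMap (List ℕ × Exp)

data InR : Heap → Val → ℕ → Set where
  rHere : ∀ {h ℓ c} → look h ℓ ≡ just c → InR h (loc ℓ) ℓ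
  rHd   : ∀ {h ℓ c v ℓ'} → look h ℓ ≡ just c → hd c ≡ just v →
          InR (remove ℓ h) v ℓ' → InR h (loc ℓ) ℓ'
  rTl   : ∀ {h ℓ c v ℓ'} → look h ℓ ≡ just c → tl c ≡ just v →
          InR (remove ℓ h) v ℓ' → InR h (loc ℓ) ℓ'

InRStore : Heap → Store → Exp → ℕ → Set
InRStore h s e ℓ = ∃ λ z → ∃ λ v → z ∈FV e × look s z ≡ just v × InR h v ℓ

evalOp : Binop → ℤ → ℤ → Maybe ℤ
evalOp bplus a b = just (a ℤ.+ b)
evalOp bminus a b = just (a ℤ.- b)
evalOp bdiv a +0 = nothing
evalOp bdiv a +[1+ n ] = just (a / +[1+ n ])
evalOp bdiv a -[1+ n ] = just (a / -[1+ n ])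
evalOp bmod a +0 = nothing
evalOp bmod a +[1+ n ] = just (+ (a % +[1+ n ]))
evalOp bmod a -[1+ n ] = just (+ (a % -[1+ n ]))

mutual
  data EvB (s : Store) (h : Heap) (C : Closure) : BExp → Val → Heap → Set where
    evConst : ∀ {c} → EvB s h C (bconst c) (cnst c) h
    evOp    : ∀ {o x y a b r} → look s x ≡ just (cnst a) → look s y ≡ just (cnst b) →
              evalOp o a b ≡ just r → EvB s h C (bop o x y) (cnst r) h
    evNil   : EvB s h C bnil NULL h
    evVar   : ∀ {z v} → look s z ≡ just v → EvB s h C (bvar z) v h
    evCons  : ∀ {z l v₁ v₂ ℓ} → look s z ≡ just v₁ → look s l ≡ just v₂ →
              look h ℓ ≡ nothing →
              EvB s h C (bcons z l) (loc ℓ) (insert ℓ (mkCell (just v₁) (just v₂)) h)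
    evApp   : ∀ {f zs zs' ef vs v h'} → look C f ≡ just (zs' , ef) →
              (∀ z → z ∈FV ef → z ∈ zs') →
              Pointwise (λ z v → look s z ≡ just v) zs vs →
              length zs' ≡ length vs →
              EvE (build zs' vs) h C ef v h' →
              EvB s h C (bapp f zs) v h'

  data EvE (s : Store) (h : Heap) (C : Closure) : Exp → Val → Heap → Set where
    evBasic : ∀ {b v h'} → EvB s h C b v h' → EvE s h C (basic b) v h'
    evLet   : ∀ {z b e v₁ h₁ v h'} → EvB s h C b v₁ h₁ →
              EvE (insert z v₁ s) h₁ C e v h' →
              (∀ ℓ → InRStore h s e ℓ → look h ℓ ≡ look h₁ ℓ) →
              EvE s h C (elet z b e) v h'
    evIfT   : ∀ {x e₁ e₂ u v h'} → look s x ≡ just u → u ≢ cnst 0ℤ →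
              EvE s h C e₁ v h' → EvE s h C (eif x e₁ e₂) v h'
    evIfF   : ∀ {x e₁ e₂ v h'} → look s x ≡ just (cnst 0ℤ) →
              EvE s h C e₂ v h' → EvE s h C (eif x e₁ e₂) v h'
    evMatchNil : ∀ {l e₁ hd tl e₂ v h'} → look s l ≡ just NULL →
              EvE s h C e₁ v h' → EvE s h C (ematch l e₁ hd tl e₂) v h'
    evMatchCons : ∀ {l e₁ x y e₂ ℓ c vh vt v h'} → look s l ≡ just (loc ℓ) →
              look h ℓ ≡ just c → hd c ≡ just vh → tl c ≡ just vt →
              EvE (insert y vt (insert x vh s)) h C e₂ v h' →
              EvE s h C (ematch l e₁ x y e₂) v h'
    evLetFun : ∀ {f zs e₁ e₂ v h'} → EvE s h (insert f (zs , e₁) C) e₂ v h' →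
              EvE s h C (eletfun f zs e₁ e₂) v h'

data GTy : Set where
  gInt  : GTy
  gList : GTy → ℚ → GTy

inst : (ℕ → GTy) → (ℕ → ℕ) → Ty → GTy
inst η ε tInt = gInt
inst η ε (tVar a) = η a
inst η ε (tList τ p) = gList (inst η ε τ) (⟦ p ⟧ ε)

data SVal : Set where
  sint  : ℤ → SVal
  snil  : SVal
  scons : SVal → SVal → SVal

data Models : Heap → Val → GTy → SVal → Set where
  mdInt  : ∀ {h c} → Models h (cnst c) gInt (sint c)
  mdNil  : ∀ {h τ q} → q ≡ 0ℚ → Models h NULL (gList τ q) snil
  mdCons : ∀ {h τ q ℓ c vh vt wh wt} (n : ℕ) → q ≡ ℕtoℚ (suc n) →
           look h ℓ ≡ just c → hd c ≡ just vh → tl c ≡ just vt →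
           Models (remove ℓ h) vh τ wh →
           Models (remove ℓ h) vt (gList τ (ℕtoℚ n)) wt →
           Models h (loc ℓ) (gList τ q) (scons wh wt)

module Submission where

-- Soundness of the sized-type system (Lemma 3.2), by induction on the
-- evaluation derivation, simultaneously for basic expressions and
-- expressions, with the invariant that the closure implements, with the
-- right signatures, every function currently in scope (ClosureOK).
--
-- Most cases are direct consequences of basic properties of the heap
-- semantics v ⊨ʰ_τ w: invariance under heap extension and under changes
-- outside the footprint (for let), inversion of list cells (for match),
-- allocation (for cons) and soundness of type equality D ⊢ τ = τ'.
--
-- The interesting case is a function call.  Instantiating the formal size
-- variables by the actual size expressions gives them rational values ρ that
-- need not be natural, while the body is only known to be sound for natural
-- valuations.  The body is used for every natural valuation compatible with
-- ρ; a size that has the same natural value under all of these has that value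
-- under ρ too, because a polynomial that is constant on the naturals in each
-- variable is constant (constant-on-naturals, proved via the remainder
-- theorem for univariate polynomials over ℚ).

open import Defs
open import Data.Nat as N using (ℕ; zero; suc)
import Data.Nat.Properties as NP
open import Data.Integer as Z using (+_; +[1+_]; -[1+_])
import Data.Integer.Properties as ZP
import Data.Sign as Sign
open import Data.Rational as Q using (ℚ; mkℚ; 0ℚ; 1ℚ; _+_; _*_; _-_; -_)
import Data.Rational.Properties as QP
import Data.Rational.Unnormalised as U
import Data.Rational.Unnormalised.Properties as UP
open import Data.Rational.Solver using (module +-*-Solver)
open +-*-Solver using (solve; _:+_; _:*_; _:-_; :-_; _:=_; con)
open import Data.Nat.Coprimality using (1-coprimeTo)
import Data.Nat.Coprimality as Coprime
open import Data.Maybe using (Maybe; just; nothing)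
open import Data.Maybe.Properties using (just-injective)
open import Data.List using (List; []; _∷_; length; _++_; filter)
open import Data.List.Membership.Propositional using (_∈_; _∉_)
open import Data.List.Membership.DecPropositional N._≟_ using (_∈?_)
import Data.List.Membership.Propositional.Properties as ∈P
open import Data.List.Relation.Unary.Any using (here; there)
import Data.List.Relation.Unary.All as All
open import Data.List.Relation.Binary.Pointwise using (Pointwise; []; _∷_)
open import Data.Product using (∃; _×_; _,_; proj₁; proj₂)
open import Data.Sum using (inj₁; inj₂)
open import Data.Empty using (⊥-elim)
open import Relation.Nullary using (Dec; yes; no; ¬?)
open import Relation.Binary.PropositionalEquality
  using (_≡_; _≢_; refl; cong; cong₂; trans; subst; sym; module ≡-Reasoning)

-- Natural numbers inside ℚ.  Sizes are evaluated in ℚ, and the list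
-- semantics only ever produces lengths of the form ℕtoℚ n.

ℕtoℚ-canonical : ∀ n → ℕtoℚ n ≡ mkℚ (+ n) 0 (Coprime.sym (1-coprimeTo n))
ℕtoℚ-canonical n = QP.normalize-coprime (Coprime.sym (1-coprimeTo n))

ℕtoℚ-injective : ∀ {m n} → ℕtoℚ m ≡ ℕtoℚ n → m ≡ n
ℕtoℚ-injective {m} {n} eq =
  ZP.+-injective (cong Q.↥_ (trans (sym (ℕtoℚ-canonical m)) (trans eq (ℕtoℚ-canonical n))))

ℕtoℚ-suc≢0 : ∀ n → ℕtoℚ (suc n) ≢ 0ℚ
ℕtoℚ-suc≢0 n eq with ℕtoℚ-injective {suc n} {0} eq
... | ()

ℕtoℚ-suc : ∀ n → ℕtoℚ (suc n) ≡ ℕtoℚ n + 1ℚ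
ℕtoℚ-suc n = QP.toℚᵘ-injective (UP.≃-trans unnormalised (UP.≃-sym (QP.toℚᵘ-homo-+ (ℕtoℚ n) 1ℚ)))
  where
  unnormalised : Q.toℚᵘ (ℕtoℚ (suc n)) U.≃ (Q.toℚᵘ (ℕtoℚ n) U.+ Q.toℚᵘ 1ℚ)
  unnormalised rewrite ℕtoℚ-canonical n | ℕtoℚ-canonical (suc n) = U.*≡* cross
    where
    cross : +[1+ n ] Z.* + 1 ≡ (Z._◃_ Sign.+ (n N.* 1) Z.+ + 1) Z.* + 1
    cross rewrite ZP.*-identityʳ +[1+ n ] | ZP.*-identityʳ (Z._◃_ Sign.+ (n N.* 1) Z.+ + 1)
                | NP.*-identityʳ n | ZP.+◃n≡+n n | NP.+-comm n 1 = refl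

ℕtoℚ-+ : ∀ m n → ℕtoℚ (m N.+ n) ≡ ℕtoℚ m + ℕtoℚ n
ℕtoℚ-+ zero n = sym (QP.+-identityˡ (ℕtoℚ n))
ℕtoℚ-+ (suc m) n rewrite ℕtoℚ-suc (m N.+ n) | ℕtoℚ-suc m | ℕtoℚ-+ m n =
  solve 3 (λ x y z → (x :+ y) :+ z := (x :+ z) :+ y) refl (ℕtoℚ m) (ℕtoℚ n) 1ℚ

ℕtoℚ-pred : ∀ n → ℕtoℚ (suc n) + - 1ℚ ≡ ℕtoℚ n
ℕtoℚ-pred n rewrite ℕtoℚ-suc n = solve 1 (λ a → (a :+ con 1ℚ) :+ (:- con 1ℚ) := a) refl (ℕtoℚ n)

IsNat : ℚ → Set
IsNat q = ∃ λ n → q ≡ ℕtoℚ n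

isNat? : ∀ q → Dec (IsNat q)
isNat? (mkℚ (+ n) zero _) = yes (n , sym (ℕtoℚ-canonical n))
isNat? (mkℚ (+ n) (suc d) _) = no λ { (m , eq) → noDenominator (cong Q.↧ₙ_ (trans eq (ℕtoℚ-canonical m))) }
  where noDenominator : suc (suc d) ≢ 1
        noDenominator ()
isNat? (mkℚ -[1+ n ] d _) = no λ { (m , eq) → notNegative (cong Q.↥_ (trans eq (ℕtoℚ-canonical m))) }
  where notNegative : ∀ {m} → -[1+ n ] ≢ + m
        notNegative ()

-- The natural number a rational denotes, and 0 if it is not a natural.
natPart : ℚ → ℕ
natPart q with isNat? q
... | yes (n , _) = n
... | no _ = 0

natPart-ℕtoℚ : ∀ {q n} → q ≡ ℕtoℚ n → natPart q ≡ n
natPart-ℕtoℚ {q} {n} eq with isNat? q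
... | yes (m , e) = ℕtoℚ-injective (trans (sym e) eq)
... | no notNat = ⊥-elim (notNat (n , eq))

ℕtoℚ-natPart : ∀ {q} → IsNat q → ℕtoℚ (natPart q) ≡ q
ℕtoℚ-natPart {q} (n , e) = trans (cong ℕtoℚ (natPart-ℕtoℚ {q} {n} e)) (sym e)

*-zero-cancelˡ : ∀ a b → a * b ≡ 0ℚ → a ≢ 0ℚ → b ≡ 0ℚ
*-zero-cancelˡ a b ab≡0 a≢0 = begin
    b              ≡⟨ sym (QP.*-identityˡ b) ⟩
    1ℚ * b         ≡⟨ cong (_* b) (sym (QP.*-inverseˡ a {{nz}})) ⟩
    (a⁻¹ * a) * b  ≡⟨ QP.*-assoc a⁻¹ a b ⟩
    a⁻¹ * (a * b)  ≡⟨ cong (a⁻¹ *_) ab≡0 ⟩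
    a⁻¹ * 0ℚ       ≡⟨ QP.*-zeroʳ a⁻¹ ⟩
    0ℚ             ∎
  where
  open ≡-Reasoning
  nz : Q.NonZero a
  nz = Q.≢-nonZero a≢0
  a⁻¹ : ℚ
  a⁻¹ = Q.1/_ a {{nz}}

-- Univariate polynomials over ℚ as coefficient lists, lowest degree first.

eval : List ℚ → ℚ → ℚ
eval [] x = 0ℚ
eval (a ∷ P) x = a + x * eval P x

-- Synthetic division by (x - r): the quotient, of the same length as P.
quotient : ℚ → List ℚ → List ℚ
quotient r [] = []
quotient r (b ∷ P) = eval (b ∷ P) r ∷ quotient r P

quotient-length : ∀ r P → length (quotient r P) ≡ length P
quotient-length r [] = refl
quotient-length r (b ∷ P) = cong suc (quotient-length r P)

remainder-theorem : ∀ a P x r → eval (a ∷ P) x ≡ eval (a ∷ P) r + (x - r) * eval (quotient r P) x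
remainder-theorem a [] x r =
  solve 3 (λ a x r → a :+ x :* con 0ℚ := (a :+ r :* con 0ℚ) :+ (x :- r) :* con 0ℚ) refl a x r
remainder-theorem a (b ∷ P) x r rewrite remainder-theorem b P x r =
  solve 5 (λ a x r p q → a :+ x :* (p :+ (x :- r) :* q) := (a :+ r :* p) :+ (x :- r) :* (p :+ x :* q))
    refl a x r (eval (b ∷ P) r) (eval (quotient r P) x)

-- Induction on the length: (a ∷ P)(x) = c + (x - m) · Q(x), and
-- Q vanishes at m+1, m+2, … because x - m ≠ 0 there.
constant-from-naturals : ∀ n P → length P ≡ n → ∀ c m →
  (∀ j → eval P (ℕtoℚ (m N.+ j)) ≡ c) → ∀ x → eval P x ≡ c
constant-from-naturals n [] _ c m agree x = agree 0
constant-from-naturals (suc n) (a ∷ P) len c m agree x = begin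
    eval (a ∷ P) x                               ≡⟨ remainder-theorem a P x r ⟩
    eval (a ∷ P) r + (x - r) * eval Q x          ≡⟨ cong₂ (λ u v → u + (x - r) * v) agree-m (Q≡0 x) ⟩
    c + (x - r) * 0ℚ                             ≡⟨ solve 2 (λ c y → c :+ y :* con 0ℚ := c) refl c (x - r) ⟩
    c                                            ∎
  where
  open ≡-Reasoning
  r : ℚ
  r = ℕtoℚ m
  Q : List ℚ
  Q = quotient r P
  agree-m : eval (a ∷ P) r ≡ c
  agree-m = subst (λ k → eval (a ∷ P) (ℕtoℚ k) ≡ c) (NP.+-identityʳ m) (agree 0)
  Q-vanishes : ∀ j → eval Q (ℕtoℚ (m N.+ suc j)) ≡ 0ℚ
  Q-vanishes j = *-zero-cancelˡ (y - r) (eval Q y) product y-r≢0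
    where
    y : ℚ
    y = ℕtoℚ (m N.+ suc j)
    y-r≢0 : y - r ≢ 0ℚ
    y-r≢0 rewrite ℕtoℚ-+ m (suc j) =
      subst (_≢ 0ℚ) (solve 2 (λ a b → b := (a :+ b) :- a) refl r (ℕtoℚ (suc j))) (ℕtoℚ-suc≢0 j)
    product : (y - r) * eval Q y ≡ 0ℚ
    product = begin
      (y - r) * eval Q y                        ≡⟨ solve 3 (λ c u v → u :* v := (c :+ u :* v) :- c) refl c (y - r) (eval Q y) ⟩
      (c + (y - r) * eval Q y) - c              ≡⟨ cong (λ u → (u + (y - r) * eval Q y) - c) (sym agree-m) ⟩
      (eval (a ∷ P) r + (y - r) * eval Q y) - c ≡⟨ cong (_- c) (sym (remainder-theorem a P y r)) ⟩
      eval (a ∷ P) y - c                        ≡⟨ cong (_- c) (agree (suc j)) ⟩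
      c - c                                     ≡⟨ QP.+-inverseʳ c ⟩
      0ℚ                                        ∎
  Q≡0 : ∀ x → eval Q x ≡ 0ℚ
  Q≡0 = constant-from-naturals n Q (trans (quotient-length r P) (NP.suc-injective len)) 0ℚ (suc m)
          (λ j → subst (λ k → eval Q (ℕtoℚ k) ≡ 0ℚ) (NP.+-suc m j) (Q-vanishes j))

padd : List ℚ → List ℚ → List ℚ
padd [] Q = Q
padd (a ∷ P) [] = a ∷ P
padd (a ∷ P) (b ∷ Q) = (a + b) ∷ padd P Q

eval-padd : ∀ P Q x → eval (padd P Q) x ≡ eval P x + eval Q x
eval-padd [] Q x = sym (QP.+-identityˡ _)
eval-padd (a ∷ P) [] x = sym (QP.+-identityʳ _)
eval-padd (a ∷ P) (b ∷ Q) x rewrite eval-padd P Q x =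
  solve 5 (λ a b x p q → (a :+ b) :+ x :* (p :+ q) := (a :+ x :* p) :+ (b :+ x :* q))
    refl a b x (eval P x) (eval Q x)

pscale : ℚ → List ℚ → List ℚ
pscale c [] = []
pscale c (a ∷ P) = c * a ∷ pscale c P

eval-pscale : ∀ c P x → eval (pscale c P) x ≡ c * eval P x
eval-pscale c [] x = sym (QP.*-zeroʳ c)
eval-pscale c (a ∷ P) x rewrite eval-pscale c P x =
  solve 4 (λ c a x p → c :* a :+ x :* (c :* p) := c :* (a :+ x :* p)) refl c a x (eval P x)

pmul : List ℚ → List ℚ → List ℚ
pmul [] Q = []
pmul (a ∷ P) Q = padd (pscale a Q) (0ℚ ∷ pmul P Q)

eval-pmul : ∀ P Q x → eval (pmul P Q) x ≡ eval P x * eval Q x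
eval-pmul [] Q x = sym (QP.*-zeroˡ (eval Q x))
eval-pmul (a ∷ P) Q x
  rewrite eval-padd (pscale a Q) (0ℚ ∷ pmul P Q) x | eval-pscale a Q x | eval-pmul P Q x =
  solve 4 (λ a x p q → a :* q :+ (con 0ℚ :+ x :* (p :* q)) := (a :+ x :* p) :* q)
    refl a x (eval P x) (eval Q x)

⟦_⟧ᵣ : SExp → (ℕ → ℚ) → ℚ
⟦ sconst q ⟧ᵣ ρ = q
⟦ svar i ⟧ᵣ ρ = ρ i
⟦ p ⊕ q ⟧ᵣ ρ = ⟦ p ⟧ᵣ ρ + ⟦ q ⟧ᵣ ρ
⟦ p ⊗ q ⟧ᵣ ρ = ⟦ p ⟧ᵣ ρ * ⟦ q ⟧ᵣ ρ

⟦⟧-as-rational : ∀ p ε → ⟦ p ⟧ ε ≡ ⟦ p ⟧ᵣ (λ k → ℕtoℚ (ε k))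
⟦⟧-as-rational (sconst q) ε = refl
⟦⟧-as-rational (svar i) ε = refl
⟦⟧-as-rational (p ⊕ q) ε = cong₂ _+_ (⟦⟧-as-rational p ε) (⟦⟧-as-rational q ε)
⟦⟧-as-rational (p ⊗ q) ε = cong₂ _*_ (⟦⟧-as-rational p ε) (⟦⟧-as-rational q ε)

vars : SExp → List ℕ
vars (sconst q) = []
vars (svar i) = i ∷ []
vars (p ⊕ q) = vars p ++ vars q
vars (p ⊗ q) = vars p ++ vars q

⟦⟧ᵣ-local : ∀ p ρ ρ' → (∀ k → k ∈ vars p → ρ k ≡ ρ' k) → ⟦ p ⟧ᵣ ρ ≡ ⟦ p ⟧ᵣ ρ'
⟦⟧ᵣ-local (sconst q) ρ ρ' same = refl
⟦⟧ᵣ-local (svar i) ρ ρ' same = same i (here refl)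
⟦⟧ᵣ-local (p ⊕ q) ρ ρ' same =
  cong₂ _+_ (⟦⟧ᵣ-local p ρ ρ' (λ k k∈ → same k (∈P.∈-++⁺ˡ k∈)))
            (⟦⟧ᵣ-local q ρ ρ' (λ k k∈ → same k (∈P.∈-++⁺ʳ (vars p) k∈)))
⟦⟧ᵣ-local (p ⊗ q) ρ ρ' same =
  cong₂ _*_ (⟦⟧ᵣ-local p ρ ρ' (λ k k∈ → same k (∈P.∈-++⁺ˡ k∈)))
            (⟦⟧ᵣ-local q ρ ρ' (λ k k∈ → same k (∈P.∈-++⁺ʳ (vars p) k∈)))

assign : (ℕ → ℚ) → ℕ → ℚ → ℕ → ℚ
assign ρ k x k' with k' N.≟ k
... | yes _ = x
... | no _ = ρ k'

assign-same : ∀ ρ k x → assign ρ k x k ≡ x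
assign-same ρ k x with k N.≟ k
... | yes _ = refl
... | no k≢k = ⊥-elim (k≢k refl)

assign-other : ∀ ρ k x k' → k' ≢ k → assign ρ k x k' ≡ ρ k'
assign-other ρ k x k' k'≢k with k' N.≟ k
... | yes k'≡k = ⊥-elim (k'≢k k'≡k)
... | no _ = refl

assign-own : ∀ ρ k k' → assign ρ k (ρ k) k' ≡ ρ k'
assign-own ρ k k' with k' N.≟ k
... | yes refl = refl
... | no _ = refl

toPoly : ℕ → (ℕ → ℚ) → SExp → List ℚ
toPoly k ρ (sconst q) = q ∷ []
toPoly k ρ (svar i) with i N.≟ k
... | yes _ = 0ℚ ∷ 1ℚ ∷ []
... | no _ = ρ i ∷ []
toPoly k ρ (p ⊕ q) = padd (toPoly k ρ p) (toPoly k ρ q)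
toPoly k ρ (p ⊗ q) = pmul (toPoly k ρ p) (toPoly k ρ q)

eval-constant : ∀ q x → eval (q ∷ []) x ≡ q
eval-constant q x = solve 2 (λ q x → q :+ x :* con 0ℚ := q) refl q x

eval-toPoly : ∀ k ρ p x → eval (toPoly k ρ p) x ≡ ⟦ p ⟧ᵣ (assign ρ k x)
eval-toPoly k ρ (sconst q) x = eval-constant q x
eval-toPoly k ρ (svar i) x with i N.≟ k
... | yes refl = solve 1 (λ x → con 0ℚ :+ x :* (con 1ℚ :+ x :* con 0ℚ) := x) refl x
... | no _ = eval-constant (ρ i) x
eval-toPoly k ρ (p ⊕ q) x =
  trans (eval-padd (toPoly k ρ p) (toPoly k ρ q) x) (cong₂ _+_ (eval-toPoly k ρ p x) (eval-toPoly k ρ q x))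
eval-toPoly k ρ (p ⊗ q) x =
  trans (eval-pmul (toPoly k ρ p) (toPoly k ρ q) x) (cong₂ _*_ (eval-toPoly k ρ p x) (eval-toPoly k ρ q x))

-- Induction on
-- ks: as a polynomial in the first variable k it is constant on ℕ, hence
-- constant.
constant-on-naturals : ∀ (ks : List ℕ) p c ρ₀ →
  (∀ ρ → (∀ k → k ∉ ks → ρ k ≡ ρ₀ k) → (∀ k → k ∈ ks → IsNat (ρ k)) → ⟦ p ⟧ᵣ ρ ≡ c) →
  ⟦ p ⟧ᵣ ρ₀ ≡ c
constant-on-naturals [] p c ρ₀ agree = agree ρ₀ (λ _ _ → refl) (λ _ ())
constant-on-naturals (k ∷ ks) p c ρ₀ agree = begin
    ⟦ p ⟧ᵣ ρ₀                     ≡⟨ ⟦⟧ᵣ-local p ρ₀ _ (λ j _ → sym (assign-own ρ₀ k j)) ⟩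
    ⟦ p ⟧ᵣ (assign ρ₀ k (ρ₀ k))   ≡⟨ sym (eval-toPoly k ρ₀ p (ρ₀ k)) ⟩
    eval (toPoly k ρ₀ p) (ρ₀ k)   ≡⟨ constant-from-naturals _ (toPoly k ρ₀ p) refl c 0 at-naturals (ρ₀ k) ⟩
    c                             ∎
  where
  open ≡-Reasoning
  at-naturals : ∀ n → eval (toPoly k ρ₀ p) (ℕtoℚ n) ≡ c
  at-naturals n = trans (eval-toPoly k ρ₀ p (ℕtoℚ n)) (constant-on-naturals ks p c (assign ρ₀ k (ℕtoℚ n)) agree′)
    where
    agree′ : ∀ ρ → (∀ j → j ∉ ks → ρ j ≡ assign ρ₀ k (ℕtoℚ n) j) → (∀ j → j ∈ ks → IsNat (ρ j)) →
             ⟦ p ⟧ᵣ ρ ≡ c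
    agree′ ρ outside natural = agree ρ outside′ natural′
      where
      outside′ : ∀ j → j ∉ k ∷ ks → ρ j ≡ ρ₀ j
      outside′ j j∉ = trans (outside j (λ j∈ → j∉ (there j∈))) (assign-other ρ₀ k _ j (λ j≡k → j∉ (here j≡k)))
      natural′ : ∀ j → j ∈ k ∷ ks → IsNat (ρ j)
      natural′ j (there j∈) = natural j j∈
      natural′ j (here refl) with j ∈? ks
      ... | yes j∈ = natural j j∈
      ... | no j∉ = n , trans (outside j j∉) (assign-same ρ₀ j _)

same-lookup : ∀ {A : Set} {x : Maybe A} {a b} → x ≡ just a → x ≡ just b → a ≡ b
same-lookup x≡a x≡b = just-injective (trans (sym x≡a) x≡b)

nothing≢just : ∀ {A : Set} {a : A} → nothing ≢ just a
nothing≢just ()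

upd-same : ∀ {A : Set} (f : ℕ → Maybe A) k x → upd f k x k ≡ x
upd-same f k x with k N.≟ k
... | yes _ = refl
... | no k≢k = ⊥-elim (k≢k refl)

_⊑_ : Heap → Heap → Set
h ⊑ h₁ = ∀ ℓ c → look h ℓ ≡ just c → look h₁ ℓ ≡ just c

remove-⊑ : ∀ h ℓ → remove ℓ h ⊑ h
remove-⊑ h ℓ ℓ' c eq with ℓ' N.≟ ℓ
... | yes refl = ⊥-elim (nothing≢just eq)
... | no _ = eq

remove-mono : ∀ {h h₁} ℓ → h ⊑ h₁ → remove ℓ h ⊑ remove ℓ h₁
remove-mono ℓ h⊑h₁ ℓ' c eq with ℓ' N.≟ ℓ
... | yes refl = ⊥-elim (nothing≢just eq)
... | no _ = h⊑h₁ ℓ' c eq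

fresh-⊑ : ∀ {h ℓ} c → look h ℓ ≡ nothing → h ⊑ remove ℓ (insert ℓ c h)
fresh-⊑ {h} {ℓ} _ fresh ℓ' c eq with ℓ' N.≟ ℓ
... | yes refl = ⊥-elim (nothing≢just (trans (sym fresh) eq))
... | no ℓ'≢ℓ = trans (upd-other (look h) ℓ _ ℓ' ℓ'≢ℓ) eq

Models-⊑ : ∀ {h h₁ v g w} → Models h v g w → h ⊑ h₁ → Models h₁ v g w
Models-⊑ mdInt _ = mdInt
Models-⊑ (mdNil q≡0) _ = mdNil q≡0
Models-⊑ {h} {h₁} (mdCons {ℓ = ℓ} n q≡ hℓ hd≡ tl≡ mh mt) h⊑h₁ =
  mdCons n q≡ (h⊑h₁ ℓ _ hℓ) hd≡ tl≡ (Models-⊑ mh removed) (Models-⊑ mt removed)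
  where
  removed : remove ℓ h ⊑ remove ℓ h₁
  removed = remove-mono {h} {h₁} ℓ h⊑h₁

Models-frame : ∀ {h h₁ v g w} → Models h v g w → (∀ ℓ → InR h v ℓ → look h ℓ ≡ look h₁ ℓ) →
               Models h₁ v g w
Models-frame mdInt _ = mdInt
Models-frame (mdNil q≡0) _ = mdNil q≡0
Models-frame {h} {h₁} (mdCons {ℓ = ℓ} n q≡ hℓ hd≡ tl≡ mh mt) agree =
  mdCons n q≡ (trans (sym (agree ℓ (rHere hℓ))) hℓ) hd≡ tl≡
    (Models-frame mh (λ ℓ' r → agree-removed ℓ' (agree ℓ' (rHd hℓ hd≡ r))))
    (Models-frame mt (λ ℓ' r → agree-removed ℓ' (agree ℓ' (rTl hℓ tl≡ r))))
  where
  agree-removed : ∀ ℓ' → look h ℓ' ≡ look h₁ ℓ' → look (remove ℓ h) ℓ' ≡ look (remove ℓ h₁) ℓ'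
  agree-removed ℓ' eq with ℓ' N.≟ ℓ
  ... | yes _ = refl
  ... | no _ = eq

length-natural : ∀ {h v g q w} → Models h v (gList g q) w → IsNat q
length-natural (mdNil q≡0) = 0 , q≡0
length-natural (mdCons n q≡ _ _ _ _ _) = suc n , q≡

length-unique : ∀ {h v g g' q q' w w'} → Models h v (gList g q) w → Models h v (gList g' q') w' → q ≡ q'
length-unique (mdNil q≡0) (mdNil q'≡0) = trans q≡0 (sym q'≡0)
length-unique (mdCons n q≡ hℓ _ tl≡ _ mt) (mdCons n' q'≡ hℓ' _ tl≡' _ mt')
  with same-lookup hℓ hℓ'
... | refl with same-lookup tl≡ tl≡'
... | refl = trans q≡ (trans (cong (λ k → ℕtoℚ (suc k)) (ℕtoℚ-injective {n} {n'} (length-unique mt mt'))) (sym q'≡))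

Models-nil : ∀ {h v g q w} → Models h v (gList g q) w → q ≡ 0ℚ → v ≡ NULL
Models-nil (mdNil _) _ = refl
Models-nil (mdCons n q≡ _ _ _ _ _) q≡0 = ⊥-elim (ℕtoℚ-suc≢0 n (trans (sym q≡) q≡0))

Models-cons-cell : ∀ {h v g n w} → Models h v (gList g (ℕtoℚ (suc n))) w →
  ∃ λ ℓ → ∃ λ c → ∃ λ vh → ∃ λ vt → v ≡ loc ℓ × look h ℓ ≡ just c × hd c ≡ just vh × tl c ≡ just vt
Models-cons-cell {n = n} (mdNil q≡0) = ⊥-elim (ℕtoℚ-suc≢0 n q≡0)
Models-cons-cell (mdCons _ _ hℓ hd≡ tl≡ _ _) = _ , _ , _ , _ , refl , hℓ , hd≡ , tl≡

Models-cons-inv : ∀ {h ℓ g q w c vh vt} → Models h (loc ℓ) (gList g q) w →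
  look h ℓ ≡ just c → hd c ≡ just vh → tl c ≡ just vt →
  ∃ λ n → q ≡ ℕtoℚ (suc n) × (∃ λ wh → Models (remove ℓ h) vh g wh) ×
          (∃ λ wt → Models (remove ℓ h) vt (gList g (ℕtoℚ n)) wt)
Models-cons-inv (mdCons n q≡ hℓ hd≡ tl≡ mh mt) hℓ' hd≡' tl≡' with same-lookup hℓ hℓ'
... | refl with same-lookup hd≡ hd≡' | same-lookup tl≡ tl≡'
... | refl | refl = n , q≡ , (_ , mh) , (_ , mt)

Models-length : ∀ {h v g q q' w} → q ≡ q' → Models h v (gList g q) w → Models h v (gList g q') w
Models-length refl m = m

_⊨⟨_⟩_ : Val → Heap → GTy → Set
v ⊨⟨ h ⟩ g = ∃ λ w → Models h v g w

Models-list-map : ∀ {g g' q q' h v w} → (∀ {h v w} → Models h v g w → v ⊨⟨ h ⟩ g') →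
  q ≡ q' → Models h v (gList g q) w → v ⊨⟨ h ⟩ gList g' q'
Models-list-map f q≡q' (mdNil q≡0) = _ , mdNil (trans (sym q≡q') q≡0)
Models-list-map f q≡q' (mdCons n q≡ hℓ hd≡ tl≡ mh mt) =
  _ , mdCons n (trans (sym q≡q') q≡) hℓ hd≡ tl≡ (proj₂ (f mh)) (proj₂ (Models-list-map f refl mt))

-- Type equality D ⊢ τ = τ' is sound: in a valuation satisfying D the two
-- types have the same values.  (For an empty list, the element types may differ.)
TyEq-sym : ∀ {D τ τ'} → TyEq D τ τ' → TyEq D τ' τ
TyEq-sym eqInt = eqInt
TyEq-sym (eqVar a) = eqVar a
TyEq-sym (eqList e d (inj₁ p≡0)) =
  eqList (sym e) (λ ε sat → sym (d ε sat)) (inj₁ (λ ε sat → trans (sym (d ε sat)) (p≡0 ε sat)))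
TyEq-sym (eqList e d (inj₂ t)) = eqList (sym e) (λ ε sat → sym (d ε sat)) (inj₂ (TyEq-sym t))

Models-TyEq : ∀ {D τ τ' ε η} → TyEq D τ τ' → Sat ε D →
  ∀ {h v w} → Models h v (inst η ε τ) w → v ⊨⟨ h ⟩ inst η ε τ'
Models-TyEq eqInt sat m = _ , m
Models-TyEq (eqVar a) sat m = _ , m
Models-TyEq {ε = ε} (eqList _ d (inj₁ p≡0)) sat m with Models-nil m (p≡0 ε sat)
... | refl = _ , mdNil (trans (sym (d ε sat)) (p≡0 ε sat))
Models-TyEq {ε = ε} (eqList _ d (inj₂ t)) sat m = Models-list-map (Models-TyEq t sat) (d ε sat) m

Models-alloc : ∀ {h ℓ v₁ v₂ g n q w₁ w₂} → look h ℓ ≡ nothing →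
  Models h v₁ g w₁ → Models h v₂ (gList g (ℕtoℚ n)) w₂ → q ≡ ℕtoℚ (suc n) →
  loc ℓ ⊨⟨ insert ℓ (mkCell (just v₁) (just v₂)) h ⟩ gList g q
Models-alloc {h} {ℓ} {v₁} {v₂} {n = n} fresh mh mt q≡ =
  _ , mdCons n q≡ (upd-same (look h) ℓ _) refl refl (Models-⊑ mh extended) (Models-⊑ mt extended)
  where
  extended : h ⊑ remove ℓ (insert ℓ (mkCell (just v₁) (just v₂)) h)
  extended = fresh-⊑ {h} {ℓ} (mkCell (just v₁) (just v₂)) fresh

Covers : ∀ {A B : Set} → (A → B → Set) → FMap A → FMap B → Set
Covers R m₂ m₁ = ∀ z b → look m₁ z ≡ just b → ∃ λ a → look m₂ z ≡ just a × R a b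

covers-empty : ∀ {A B : Set} {R : A → B → Set} → Covers R emptyMap emptyMap
covers-empty z b ()

covers-insert : ∀ {A B : Set} {R : A → B → Set} {m₂ m₁} z {a b} → Covers R m₂ m₁ → R a b →
                Covers R (insert z a m₂) (insert z b m₁)
covers-insert z old r x b' lk with x N.≟ z
covers-insert z old r x b' refl | yes _ = _ , refl , r
covers-insert z old r x b' lk | no _ = old x b' lk

covers-build : ∀ {A B : Set} {R : A → B → Set} zs {as bs m₁ m₂} → Covers R m₂ m₁ → Pointwise R as bs →
               Covers R (buildFrom m₂ zs as) (buildFrom m₁ zs bs)
covers-build [] old _ = old
covers-build (z ∷ zs) old [] = old
covers-build {R = R} (z ∷ zs) {m₁ = m₁} {m₂} old (r ∷ rs) =
  covers-build zs (covers-insert {R = R} {m₂} {m₁} z old r) rs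

BindsValue : Store → Heap → (ℕ → ℕ) → (ℕ → GTy) → ℕ → Ty → Set
BindsValue s h ε η z τ = ∃ λ vz → ∃ λ w → look s z ≡ just vz × Models h vz (inst η ε τ) w

record StoreOK (s : Store) (h : Heap) (Γ : Ctx) (ε : ℕ → ℕ) (η : ℕ → GTy) (P : ℕ → Set) : Set where
  constructor storeOK
  field
    binding : ∀ z τz → P z → look Γ z ≡ just τz → BindsValue s h ε η z τz
open StoreOK public

StoreOK-restrict : ∀ {s h Γ ε η P Q} → StoreOK s h Γ ε η P → (∀ z → Q z → P z) → StoreOK s h Γ ε η Q
StoreOK-restrict ok Q⊆P = storeOK (λ z τz qz → binding ok z τz (Q⊆P z qz))

StoreOK-extend : ∀ {s h Γ ε η P} z {v τ w} → StoreOK s h Γ ε η (λ x → P x × x ≢ z) →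
                 Models h v (inst η ε τ) w → StoreOK (insert z v s) h (insert z τ Γ) ε η P
StoreOK-extend {s} {h} {Γ} {ε} {η} {P} z {v} {τ} old m = storeOK bind
  where
  bind : ∀ x τx → P x → look (insert z τ Γ) x ≡ just τx → BindsValue (insert z v s) h ε η x τx
  bind x τx px lk with x N.≟ z
  bind x τx px refl | yes refl = _ , _ , refl , m
  bind x τx px lk | no x≢z = binding old x τx (px , x≢z) lk

StoreOK-frame : ∀ {s h h₁ Γ ε η P} → StoreOK s h Γ ε η P →
  (∀ x vx → P x → look s x ≡ just vx → ∀ ℓ → InR h vx ℓ → look h ℓ ≡ look h₁ ℓ) → StoreOK s h₁ Γ ε η P
StoreOK-frame {s} {h} {h₁} {Γ} {ε} {η} {P} old unchanged = storeOK bind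
  where
  bind : ∀ x τx → P x → look Γ x ≡ just τx → BindsValue s h₁ ε η x τx
  bind x τx px lk with binding old x τx px lk
  ... | vx , w , lx , m = vx , w , lx , Models-frame m (unchanged x vx px lx)

-- A call f(z₁ … zₙ) instantiates the signature of f by a
-- substitution σT (type variables) and σS (size variables ↦ size expressions
-- over the caller's variables).  In the caller's valuation ε, the formal size
-- variables get the rational values ρ k = ⟦σS k⟧ε, which need not be natural
-- (a size variable only constrained inside an empty list is unconstrained).
-- The body of f was checked for all natural valuations; we use it for every
-- valuation ε' compatible with ρ and transfer the result to ρ itself.

instᵣ : (ℕ → GTy) → (ℕ → ℚ) → Ty → GTy
instᵣ η ρ tInt = gInt
instᵣ η ρ (tVar a) = η a
instᵣ η ρ (tList τ p) = gList (instᵣ η ρ τ) (⟦ p ⟧ᵣ ρ)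

module Call (η : ℕ → GTy) (ε : ℕ → ℕ) (σT : ℕ → Ty) (σS : ℕ → SExp) where

  ρ : ℕ → ℚ
  ρ k = ⟦ σS k ⟧ ε

  η' : ℕ → GTy
  η' a = inst η ε (σT a)

  Compatible : (ℕ → ℕ) → Set
  Compatible ε' = ∀ k n → ρ k ≡ ℕtoℚ n → ε' k ≡ n

  ε₀ : ℕ → ℕ
  ε₀ k = natPart (ρ k)

  ε₀-compatible : Compatible ε₀
  ε₀-compatible k n = natPart-ℕtoℚ

  undetermined : SExp → List ℕ
  undetermined q = filter (λ k → ¬? (isNat? (ρ k))) (vars q)

  -- A size that takes the natural value m under every compatible valuation
  -- has that value under ρ: by constant-on-naturals in the undetermined
  -- variables, every natural choice of which is compatible.
  forced-size : ∀ q m → (∀ ε' → Compatible ε' → ⟦ q ⟧ ε' ≡ ℕtoℚ m) → ⟦ q ⟧ᵣ ρ ≡ ℕtoℚ m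
  forced-size q m forced = constant-on-naturals (undetermined q) q (ℕtoℚ m) ρ at-naturals
    where
    at-naturals : ∀ ρ' → (∀ k → k ∉ undetermined q → ρ' k ≡ ρ k) →
                  (∀ k → k ∈ undetermined q → IsNat (ρ' k)) → ⟦ q ⟧ᵣ ρ' ≡ ℕtoℚ m
    at-naturals ρ' outside natural = trans (sym ε'-agrees) (forced ε' ε'-compatible)
      where
      ε' : ℕ → ℕ
      ε' k = natPart (ρ' k)
      determined : ∀ {k} → IsNat (ρ k) → ρ' k ≡ ρ k
      determined isNat = outside _ (λ k∈ → proj₂ (∈P.∈-filter⁻ (λ k → ¬? (isNat? (ρ k))) {xs = vars q} k∈) isNat)
      ρ'-natural : ∀ k → k ∈ vars q → IsNat (ρ' k)
      ρ'-natural k k∈ with isNat? (ρ k)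
      ... | yes isNat = subst IsNat (sym (determined isNat)) isNat
      ... | no notNat = natural k (∈P.∈-filter⁺ (λ k → ¬? (isNat? (ρ k))) k∈ notNat)
      ε'-agrees : ⟦ q ⟧ ε' ≡ ⟦ q ⟧ᵣ ρ'
      ε'-agrees = trans (⟦⟧-as-rational q ε') (⟦⟧ᵣ-local q _ ρ' (λ k k∈ → ℕtoℚ-natPart (ρ'-natural k k∈)))
      ε'-compatible : Compatible ε'
      ε'-compatible k n ρk≡n = natPart-ℕtoℚ (trans (determined (n , ρk≡n)) ρk≡n)

  -- For lists, the length m is the same for all valuations; it is
  -- the value of the annotation under ρ by forced-size, and the elements are
  -- handled along the list by list-at-ρ.
  mutual
    result-at-ρ : ∀ τ {h v} → (∀ ε' → Compatible ε' → v ⊨⟨ h ⟩ inst η' ε' τ) → v ⊨⟨ h ⟩ instᵣ η' ρ τ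
    result-at-ρ tInt at = at ε₀ ε₀-compatible
    result-at-ρ (tVar a) at = at ε₀ ε₀-compatible
    result-at-ρ (tList τ p) {h} {v} at with at ε₀ ε₀-compatible
    ... | _ , m₀ with length-natural m₀
    ... | m , p≡m = _ , Models-length (sym p-at-ρ) (proj₂ (list-at-ρ τ m at-length-m))
      where
      length-m : ∀ ε' → Compatible ε' → ⟦ p ⟧ ε' ≡ ℕtoℚ m
      length-m ε' c = trans (length-unique (proj₂ (at ε' c)) m₀) p≡m
      at-length-m : ∀ ε' → Compatible ε' → v ⊨⟨ h ⟩ gList (inst η' ε' τ) (ℕtoℚ m)
      at-length-m ε' c = _ , Models-length (length-m ε' c) (proj₂ (at ε' c))
      p-at-ρ : ⟦ p ⟧ᵣ ρ ≡ ℕtoℚ m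
      p-at-ρ = forced-size p m length-m

    list-at-ρ : ∀ τ n {h v} → (∀ ε' → Compatible ε' → v ⊨⟨ h ⟩ gList (inst η' ε' τ) (ℕtoℚ n)) →
                v ⊨⟨ h ⟩ gList (instᵣ η' ρ τ) (ℕtoℚ n)
    list-at-ρ τ zero at with Models-nil (proj₂ (at ε₀ ε₀-compatible)) refl
    ... | refl = _ , mdNil refl
    list-at-ρ τ (suc n) {h} at with Models-cons-cell {n = n} (proj₂ (at ε₀ ε₀-compatible))
    ... | ℓ , c , vh , vt , refl , hℓ , hd≡ , tl≡ =
      _ , mdCons n refl hℓ hd≡ tl≡ (proj₂ (result-at-ρ τ head)) (proj₂ (list-at-ρ τ n tail))
      where
      head : ∀ ε' → Compatible ε' → vh ⊨⟨ remove ℓ h ⟩ inst η' ε' τ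
      head ε' c = proj₁ (proj₂ (proj₂ (Models-cons-inv (proj₂ (at ε' c)) hℓ hd≡ tl≡)))
      tail : ∀ ε' → Compatible ε' → vt ⊨⟨ remove ℓ h ⟩ gList (inst η' ε' τ) (ℕtoℚ n)
      tail ε' c with Models-cons-inv (proj₂ (at ε' c)) hℓ hd≡ tl≡
      ... | n' , q≡ , _ , mt with NP.suc-injective (ℕtoℚ-injective {suc n} {suc n'} q≡)
      ... | refl = mt

  ⟦substS⟧ : ∀ p → ⟦ substS σS p ⟧ ε ≡ ⟦ p ⟧ᵣ ρ
  ⟦substS⟧ (sconst q) = refl
  ⟦substS⟧ (svar k) = refl
  ⟦substS⟧ (p ⊕ q) = cong₂ _+_ (⟦substS⟧ p) (⟦substS⟧ q)
  ⟦substS⟧ (p ⊗ q) = cong₂ _*_ (⟦substS⟧ p) (⟦substS⟧ q)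

  instᵣ-substTy : ∀ τ → instᵣ η' ρ τ ≡ inst η ε (substTy σT σS τ)
  instᵣ-substTy tInt = refl
  instᵣ-substTy (tVar a) = refl
  instᵣ-substTy (tList τ p) = cong₂ gList (instᵣ-substTy τ) (sym (⟦substS⟧ p))

  -- An actual argument matched against a formal type τ° has type τ° under
  -- every compatible valuation: each formal size variable k matched with a
  -- list of length n has ρ k = n, hence ε' k = n.
  argument-compatible : ∀ {D τ° τ'} → Match D σT σS τ° τ' → Sat ε D → ∀ {ε'} → Compatible ε' →
    ∀ {h v w} → Models h v (inst η ε τ') w → v ⊨⟨ h ⟩ inst η' ε' τ°
  argument-compatible mInt sat c m = _ , m
  argument-compatible (mVar σTa≡τ') sat c {h} {v} {w} m =
    _ , subst (λ t → Models h v (inst η ε t) w) (sym σTa≡τ') m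
  argument-compatible (mList {k} σSk≐p' elem) sat {ε'} c m with length-natural m
  ... | n , p'≡n = Models-list-map (argument-compatible elem sat c) (trans p'≡n (cong ℕtoℚ (sym ε'k≡n))) m
    where
    ε'k≡n : ε' k ≡ n
    ε'k≡n = c k n (trans (σSk≐p' ε sat) p'≡n)

  arguments-compatible : ∀ {D s h Γ} → Sat ε D → ∀ {ε'} → Compatible ε' →
    ∀ {zs vs τs τ°s} →
    Pointwise (λ z v → look s z ≡ just v) zs vs →
    Pointwise (λ z τ → look Γ z ≡ just τ) zs τs →
    Pointwise (Match D σT σS) τ°s τs →
    StoreOK s h Γ ε η (_∈ zs) →
    Pointwise (λ v τ° → v ⊨⟨ h ⟩ inst η' ε' τ°) vs τ°s
  arguments-compatible sat c [] [] [] actuals = []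
  arguments-compatible {D} {s} {h} {Γ} sat c (sz ∷ szs) (Γz ∷ Γzs) (match ∷ matches) actuals
    with binding actuals _ _ (here refl) Γz
  ... | vz , w , sz' , m with same-lookup sz sz'
  ... | refl = argument-compatible match sat c m
               ∷ arguments-compatible {D} {s} {h} {Γ} sat c szs Γzs matches (StoreOK-restrict actuals (λ _ → there))

  -- Soundness of a call, given soundness of the body of f for every
  -- compatible valuation: the result has type res(f) under ρ, which is the
  -- instantiated result type under ε.
  call-sound : ∀ {D s h h' Γ zs zs' vs τs v τ'} {ft : FOTy} {P : ℕ → Set} → Sat ε D →
    Pointwise (λ z v → look s z ≡ just v) zs vs →
    Pointwise (λ z τ → look Γ z ≡ just τ) zs τs →
    Pointwise (Match D σT σS) (args ft) τs →
    TyEq D τ' (substTy σT σS (res ft)) →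
    StoreOK s h Γ ε η (_∈ zs) →
    (∀ ε' → Compatible ε' → StoreOK (build zs' vs) h (build zs' (args ft)) ε' η' P →
       v ⊨⟨ h' ⟩ inst η' ε' (res ft)) →
    v ⊨⟨ h' ⟩ inst η ε τ'
  call-sound {D} {s} {h} {h'} {Γ} {zs' = zs'} {vs} {v = v} {ft = ft} {P} sat sz Γz matches τ'≐res actuals body =
    Models-TyEq (TyEq-sym τ'≐res) sat (subst (λ g → Models h' v g (proj₁ at-ρ)) (instᵣ-substTy (res ft)) (proj₂ at-ρ))
    where
    parameters : ∀ ε' → Compatible ε' → StoreOK (build zs' vs) h (build zs' (args ft)) ε' η' P
    parameters ε' c = storeOK bind
      where
      bind : ∀ z τz → P z → look (build zs' (args ft)) z ≡ just τz → BindsValue (build zs' vs) h ε' η' z τz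
      bind z τz _ lk
        with covers-build zs' covers-empty (arguments-compatible {D} {s} {h} {Γ} sat c sz Γz matches actuals) z τz lk
      ... | vz , lz , (w , m) = vz , w , lz , m
    at-ρ : v ⊨⟨ h' ⟩ instᵣ η' ρ (res ft)
    at-ρ = result-at-ρ (res ft) (λ ε' c → body ε' c (parameters ε' c))

ClosureOK : Sig → List ℕ → Closure → Set
ClosureOK Σ' F C = ∀ f zs ef → f ∈ F → look C f ≡ just (zs , ef) →
  ∃ λ ft → look Σ' f ≡ just ft × TyE Σ' [] (build zs (args ft)) ef (res ft) × Declared F ef

Declared-weakenB : ∀ b {F F'} → (∀ f → f ∈ F → f ∈ F') → DeclaredB F b → DeclaredB F' b
Declared-weakenB (bconst _) F⊆F' d = d
Declared-weakenB (bvar _) F⊆F' d = d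
Declared-weakenB (bop _ _ _) F⊆F' d = d
Declared-weakenB bnil F⊆F' d = d
Declared-weakenB (bcons _ _) F⊆F' d = d
Declared-weakenB (bapp f _) F⊆F' d = F⊆F' f d

Declared-weaken : ∀ e {F F'} → (∀ f → f ∈ F → f ∈ F') → Declared F e → Declared F' e
Declared-weaken (basic b) F⊆F' d = Declared-weakenB b F⊆F' d
Declared-weaken (elet _ b e) F⊆F' (d₁ , d₂) = Declared-weakenB b F⊆F' d₁ , Declared-weaken e F⊆F' d₂
Declared-weaken (eif _ e₁ e₂) F⊆F' (d₁ , d₂) = Declared-weaken e₁ F⊆F' d₁ , Declared-weaken e₂ F⊆F' d₂
Declared-weaken (ematch _ e₁ _ _ e₂) F⊆F' (d₁ , d₂) = Declared-weaken e₁ F⊆F' d₁ , Declared-weaken e₂ F⊆F' d₂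
Declared-weaken (eletfun f _ e₁ e₂) {F} {F'} F⊆F' (d₁ , d₂) =
  Declared-weaken e₁ under-f d₁ , Declared-weaken e₂ under-f d₂
  where
  under-f : ∀ g → g ∈ f ∷ F → g ∈ f ∷ F'
  under-f g (here g≡f) = here g≡f
  under-f g (there g∈) = there (F⊆F' g g∈)
Declared-weaken (eletextern _ _ e) F⊆F' d = Declared-weaken e F⊆F' d

∈-tail : ∀ {g f : ℕ} {F} → g ≢ f → g ∈ f ∷ F → g ∈ F
∈-tail g≢f (here g≡f) = ⊥-elim (g≢f g≡f)
∈-tail g≢f (there g∈) = g∈

ClosureOK-insert : ∀ {Σ' F C f zs e₁ ft} → ClosureOK Σ' F C → look Σ' f ≡ just ft →
  TyE Σ' [] (build zs (args ft)) e₁ (res ft) → Declared (f ∷ F) e₁ →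
  ClosureOK Σ' (f ∷ F) (insert f (zs , e₁) C)
ClosureOK-insert {C = C} {f} ok Σf ty₁ d₁ g zs' ef g∈ Cg with g N.≟ f
... | yes refl with just-injective Cg
...   | refl = _ , Σf , ty₁ , d₁
ClosureOK-insert {C = C} {f} ok Σf ty₁ d₁ g zs' ef g∈ Cg | no g≢f
  with ok g zs' ef (∈-tail g≢f g∈) Cg
... | ft , Σg , ty , d = ft , Σg , ty , Declared-weaken ef (λ _ → there) d

mutual
  sound-basic : ∀ {s h C b v h'} → EvB s h C b v h' → ∀ {F Σ' D Γ τ} → TyB Σ' D Γ b τ →
    DeclaredB F b → ClosureOK Σ' F C → ∀ ε η → Sat ε D → StoreOK s h Γ ε η (_∈FVb b) →
    v ⊨⟨ h' ⟩ inst η ε τ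
  sound-basic evConst tyConst _ _ ε η sat fv = _ , mdInt
  sound-basic (evOp _ _ _) (tyOp _ _) _ _ ε η sat fv = _ , mdInt
  sound-basic evNil (tyNil p≐0) _ _ ε η sat fv = _ , mdNil (p≐0 ε sat)
  sound-basic (evVar sz) (tyVar Γz τ≐τ') _ _ ε η sat fv with binding fv _ _ fvVar Γz
  ... | _ , _ , sz' , m with same-lookup sz sz'
  ... | refl = Models-TyEq τ≐τ' sat m
  sound-basic (evCons shd stl fresh) (tyCons {p = p} Γhd Γtl p≐p'+1) _ _ ε η sat fv
    with binding fv _ _ fvConsH Γhd | binding fv _ _ fvConsT Γtl
  ... | _ , _ , shd' , mh | _ , _ , stl' , mt with same-lookup shd shd' | same-lookup stl stl' | length-natural mt
  ... | refl | refl | n , p'≡n =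
    Models-alloc {n = n} fresh mh (Models-length p'≡n mt) p≡n+1
    where
    p≡n+1 : ⟦ p ⟧ ε ≡ ℕtoℚ (suc n)
    p≡n+1 = trans (p≐p'+1 ε sat) (trans (cong (_+ 1ℚ) p'≡n) (sym (ℕtoℚ-suc n)))
  sound-basic (evApp {f} {zs} {zs'} {ef} Cf _ sz _ evBody) (tyApp ft τs σT σS Σf Γz matches _ τ'≐res)
              f∈F ok ε η sat fv
    with ok f zs' ef f∈F Cf
  ... | ft' , Σf' , tyBody , declBody with same-lookup Σf' Σf
  ... | refl = Call.call-sound η ε σT σS {zs' = zs'} {ft = ft} sat sz Γz matches τ'≐res (StoreOK-restrict fv (λ _ → fvApp))
                 (λ ε' _ parameters → sound evBody tyBody declBody ok ε' (Call.η' η ε σT σS) All.[] parameters)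

  sound : ∀ {s h C e v h'} → EvE s h C e v h' → ∀ {F Σ' D Γ τ} → TyE Σ' D Γ e τ →
    Declared F e → ClosureOK Σ' F C → ∀ ε η → Sat ε D → StoreOK s h Γ ε η (_∈FV e) →
    v ⊨⟨ h' ⟩ inst η ε τ
  sound (evBasic ev) (tyBasic ty) d ok ε η sat fv =
    sound-basic ev ty d ok ε η sat (StoreOK-restrict fv (λ _ → fvBasic))
  sound {s} {h} (evLet {z} {e = e} {v₁} {h₁} ev₁ ev₂ unchanged) {Γ = Γ} (tyLet {τz = τz} _ ty₁ ty₂)
        (d₁ , d₂) ok ε η sat fv =
    sound ev₂ ty₂ d₂ ok ε η sat (StoreOK-extend z others (proj₂ z-value))
    where
    z-value : v₁ ⊨⟨ h₁ ⟩ inst η ε τz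
    z-value = sound-basic ev₁ ty₁ d₁ ok ε η sat (StoreOK-restrict fv (λ _ → fvLet₁))
    -- the other variables of e keep their values: evaluating b left their footprint unchanged
    others : StoreOK s h₁ Γ ε η (λ x → x ∈FV e × x ≢ z)
    others = StoreOK-frame (StoreOK-restrict fv (λ _ x∈ → fvLet₂ (proj₁ x∈) (proj₂ x∈)))
                           (λ x vx x∈ sx ℓ r → unchanged ℓ (x , vx , proj₁ x∈ , sx , r))
  sound (evIfT _ _ ev₁) (tyIf _ ty₁ _) (d₁ , _) ok ε η sat fv =
    sound ev₁ ty₁ d₁ ok ε η sat (StoreOK-restrict fv (λ _ → fvIf₁))
  sound (evIfF _ ev₂) (tyIf _ _ ty₂) (_ , d₂) ok ε η sat fv =
    sound ev₂ ty₂ d₂ ok ε η sat (StoreOK-restrict fv (λ _ → fvIf₂))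
  sound (evMatchNil sl ev₁) (tyMatch Γl _ _ ty₁ _) (d₁ , _) ok ε η sat fv with binding fv _ _ fvMatch Γl
  ... | _ , _ , sl' , ml with same-lookup sl sl'
  ... | refl with ml
  ... | mdNil p≡0 = sound ev₁ ty₁ d₁ ok ε η (p≡0 All.∷ sat) (StoreOK-restrict fv (λ _ → fvMatch₁))
  sound {s} {h} (evMatchCons {x = x} {y = y} {e₂ = e₂} {ℓ = ℓ} sl hℓ hd≡ tl≡ ev₂) {Γ = Γ}
        (tyMatch {p = p} Γl _ _ _ ty₂) (_ , d₂) ok ε η sat fv with binding fv _ _ fvMatch Γl
  ... | _ , _ , sl' , ml with same-lookup sl sl'
  ... | refl with Models-cons-inv ml hℓ hd≡ tl≡
  ... | n , p≡n+1 , (_ , mh) , (_ , mt) =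
    sound ev₂ ty₂ d₂ ok ε η sat (StoreOK-extend y (StoreOK-extend x others (Models-⊑ mh (remove-⊑ h ℓ)))
                                                   (Models-⊑ (Models-length n≡p-1 mt) (remove-⊑ h ℓ)))
    where
    others : StoreOK s h Γ ε η (λ z → (z ∈FV e₂ × z ≢ y) × z ≢ x)
    others = StoreOK-restrict fv (λ _ z∈ → fvMatch₂ (proj₁ (proj₁ z∈)) (proj₂ z∈) (proj₂ (proj₁ z∈)))
    n≡p-1 : ℕtoℚ n ≡ ⟦ p ⟧ ε + - 1ℚ
    n≡p-1 = sym (trans (cong (_+ - 1ℚ) p≡n+1) (ℕtoℚ-pred n))
  sound {C = C} (evLetFun ev₂) {F} (tyLetFun {zs = zs} ft Σf _ ty₁ ty₂) (d₁ , d₂) ok ε η sat fv =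
    sound ev₂ ty₂ d₂ (ClosureOK-insert {F = F} {C} {zs = zs} ok Σf ty₁ d₁) ε η sat (StoreOK-restrict fv (λ _ → fvFun₂))

lemma3p2 : ∀ {s : Store} {h h' : Heap} {C : Closure} {e : Exp} {v : Val} →
           EvE s h C e v h' →
           ∀ {D : Constraints} {Γ : Ctx} {Σ' : Sig} {τ : Ty} →
           TyE Σ' D Γ e τ →
           Declared [] e →
           ∀ (ε : ℕ → ℕ) (η : ℕ → GTy) →
           Sat ε D →
           (∀ z τz → z ∈FV e → look Γ z ≡ just τz →
              ∃ λ vz → ∃ λ w → look s z ≡ just vz × Models h vz (inst η ε τz) w) →
           ∃ λ w' → Models h' v (inst η ε τ) w'
lemma3p2 {C = C} ev {Σ' = Σ'} ty declared ε η sat fv =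
  sound ev ty declared no-functions-yet ε η sat (storeOK fv)
  where
  no-functions-yet : ClosureOK Σ' [] C
  no-functions-yet f zs ef ()
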